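{- The system $\mathrm{CLC}_0$ has the unique normal form property: if $t_1$ and $t_2$ are in $\mathrm{CLC}_0$-normal form and $t_1 =_{\mathrm{CLC}_0} t_2$, then $t_1$ and $t_2$ are syntactically identical.
   Context: Terms are built from variables and the constants $C,T,F,K,S$ by binary application, left-associated. $\mathrm{CLC}_0$ is the (unconditional) term rewriting system with rules $C\,T\,x\,y\to x$; $C\,F\,x\,y\to y$; $C\,z\,x\,x\to x$; $K\,x\,y\to x$; $S\,x\,y\,z\to x\,z\,(y\,z)$, applicable in any context. $=_{\mathrm{CLC}_0}$ denotes convertibility (the equivalence relation generated by one-step contraction). A term is in normal form if it contains no redex. -}

module Defs where

open import Data.Nat using (ℕ)
open import Relation.Binary.Construct.Closure.ReflexiveTransitive using (Star)
open import Relation.Nullary using (¬_)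

data Term : Set where
  var : ℕ → Term
  C T F K S : Term
  _·_ : Term → Term → Term

infixl 9 _·_
infix 4 _⟶ʳ_ _⟶_ _↔_ _≐_ _⊑_

data _⟶ʳ_ : Term → Term → Set where
  CT : ∀ x y → C · T · x · y ⟶ʳ x
  CF : ∀ x y → C · F · x · y ⟶ʳ y
  Cxx : ∀ z x → C · z · x · x ⟶ʳ x
  Kxy : ∀ x y → K · x · y ⟶ʳ x
  Sxyz : ∀ x y z → S · x · y · z ⟶ʳ x · z · (y · z)

data _⟶_ : Term → Term → Set where
  root : ∀ {s t} → s ⟶ʳ t → s ⟶ t
  appˡ : ∀ {s s′ t} → s ⟶ s′ → s · t ⟶ s′ · t
  appʳ : ∀ {s t t′} → t ⟶ t′ → s · t ⟶ s · t′

data _↔_ : Term → Term → Set where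
  fwd : ∀ {s t} → s ⟶ t → s ↔ t
  bwd : ∀ {s t} → t ⟶ s → s ↔ t

_≐_ : Term → Term → Set
s ≐ t = Star _↔_ s t

data _⊑_ : Term → Term → Set where
  here : ∀ {s} → s ⊑ s
  inl : ∀ {s u v} → s ⊑ u → s ⊑ u · v
  inr : ∀ {s u v} → s ⊑ v → s ⊑ u · v

NormalForm : Term → Set
NormalForm t = ∀ {s} → s ⊑ t → (u : Term) → ¬ (s ⟶ʳ u)

-- The non-left-linear rule C z x x → x defeats the usual confluence argument, so we work
-- with a parallel reduction ⇛ in which C z x y contracts whenever x ≐ y, to y if z ≐ F and
-- to x otherwise.  These side conditions depend only on convertibility classes, so they
-- survive further ⇛ steps and ⇛ has the diamond property; the one critical pair that is
-- not closed this way, C T x y with T ≐ F, is excluded by Engeler's graph model.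
-- Classically every CLC₀ step is a ⇛ step, so convertible terms have a common ⇛-reduct.
-- A normal form admits only the trivial ⇛ step: a contraction of C z x y needs x ≐ y,
-- which by induction on the smaller normal forms x and y forces x ≡ y, i.e. a C-redex.
-- Decidability of syntactic equality discharges the double negation.

module Submission where

open import Defs
open import Data.Bool using (Bool; true; false)
open import Data.Empty using (⊥; ⊥-elim)
open import Data.List using (List; []; _∷_; _++_)
open import Data.List.Membership.Propositional using (_∈_)
open import Data.List.Membership.Propositional.Properties using (∈-++⁺ˡ; ∈-++⁺ʳ)
open import Data.List.Relation.Unary.All as All using (All; []; _∷_; lookup; tabulate)
open import Data.List.Relation.Unary.All.Properties using (++⁺)
open import Data.List.Relation.Unary.Any using (here; there)
import Data.Nat as ℕ
open import Data.Product using (∃-syntax; ∃₂; _×_; _,_; proj₁; uncurry)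
open import Data.Sum using (_⊎_; inj₁; inj₂)
open import Effect.Monad using (RawMonad)
open import Function using (_∘_; id)
open import Level using (_⊔_; 0ℓ)
open import Relation.Binary.Core using (Rel)
open import Relation.Binary.Definitions using (DecidableEquality)
open import Relation.Binary.PropositionalEquality using (_≡_; refl; sym; trans; cong; cong₂)
open import Relation.Binary.Construct.Closure.ReflexiveTransitive as Star using (Star; ε; _◅_; _◅◅_)
open import Relation.Binary.Construct.Closure.Equivalence using (EqClosure)
open import Relation.Binary.Construct.Closure.Symmetric using (fwd; bwd)
open import Relation.Binary.Rewriting using (Confluent)
open import Relation.Nullary using (¬_; Dec; yes; no)
open import Relation.Nullary.Decidable using (decidable-stable; map′; _×-dec_; ¬¬-excluded-middle)
open import Relation.Nullary.Negation using (¬¬-Monad; ¬¬-map)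
open import Relation.Unary using (Pred; _⊆_; ∅; ｛_｝) renaming (_≐_ to _≋_)
open import Relation.Unary.Properties using () renaming (≐-refl to ≋-refl; ≐-sym to ≋-sym; ≐-trans to ≋-trans)

Diamond : ∀ {a ℓ} {A : Set a} → Rel A ℓ → Set (a ⊔ ℓ)
Diamond R = ∀ {s t u} → R s t → R s u → ∃[ v ] R t v × R u v

module _ {a ℓ} {A : Set a} {R : Rel A ℓ} where

  diamond-strip : Diamond R → ∀ {s t u} → R s t → Star R s u → ∃[ v ] Star R t v × R u v
  diamond-strip ◇ r ε = _ , ε , r
  diamond-strip ◇ r (r′ ◅ rs) with ◇ r r′
  ... | _ , tv , uv with diamond-strip ◇ uv rs
  ...   | w , vw , uw = w , tv ◅ vw , uw

  diamond⇒confluent : Diamond R → Confluent R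
  diamond⇒confluent ◇ ε ss = _ , ss , ε
  diamond⇒confluent ◇ (r ◅ rs) ss with diamond-strip ◇ r ss
  ... | _ , ts , us with diamond⇒confluent ◇ rs ts
  ...   | w , xw , sw = w , xw , us ◅ sw

  confluent⇒church-rosser : Confluent R → ∀ {s t} → EqClosure R s t → ∃[ u ] Star R s u × Star R t u
  confluent⇒church-rosser conf ε = _ , ε , ε
  confluent⇒church-rosser conf (fwd r ◅ c) with confluent⇒church-rosser conf c
  ... | u , su , tu = u , r ◅ su , tu
  confluent⇒church-rosser conf (bwd r ◅ c) with confluent⇒church-rosser conf c
  ... | u , su , tu with conf (r ◅ ε) su
  ...   | v , sv , uv = v , sv , tu ◅◅ uv

↔-sym : ∀ {s t} → s ↔ t → t ↔ s
↔-sym (fwd r) = bwd r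
↔-sym (bwd r) = fwd r

≐-sym : ∀ {s t} → s ≐ t → t ≐ s
≐-sym = Star.reverse ↔-sym

≐-·ˡ : ∀ {s s′} t → s ≐ s′ → s · t ≐ s′ · t
≐-·ˡ t = Star.gmap (_· t) λ { (fwd r) → fwd (appˡ r) ; (bwd r) → bwd (appˡ r) }

≐-·ʳ : ∀ s {t t′} → t ≐ t′ → s · t ≐ s · t′
≐-·ʳ s = Star.gmap (s ·_) λ { (fwd r) → fwd (appʳ r) ; (bwd r) → bwd (appʳ r) }

≐-· : ∀ {s s′ t t′} → s ≐ s′ → t ≐ t′ → s · t ≐ s′ · t′
≐-· {s′ = s′} {t = t} ss′ tt′ = ≐-·ˡ t ss′ ◅◅ ≐-·ʳ s′ tt′

⟶ʳ⇒≐ : ∀ {s t} → s ⟶ʳ t → s ≐ t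
⟶ʳ⇒≐ r = fwd (root r) ◅ ε

module EngelerModel where

  data Code : Set where
    atom : Bool → Code
    _⇨_ : List Code → Code → Code

  infixr 5 _⇨_
  infixl 9 _∙_

  𝒫 : Set₁
  𝒫 = Pred Code 0ℓ

  ⟨_⟩ : List Code → 𝒫
  ⟨ α ⟩ c = c ∈ α

  data _∙_ (X Y : 𝒫) (b : Code) : Set where
    app : ∀ {β} → All Y β → X (β ⇨ b) → (X ∙ Y) b

  ∙-mono : ∀ {X X′ Y Y′} → X ⊆ X′ → Y ⊆ Y′ → X ∙ Y ⊆ X′ ∙ Y′
  ∙-mono X⊆X′ Y⊆Y′ (app Yβ x) = app (All.map Y⊆Y′ Yβ) (X⊆X′ x)

  ∙-cong : ∀ {X X′ Y Y′} → X ≋ X′ → Y ≋ Y′ → X ∙ Y ≋ X′ ∙ Y′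
  ∙-cong (X⊆X′ , X′⊆X) (Y⊆Y′ , Y′⊆Y) = ∙-mono X⊆X′ Y⊆Y′ , ∙-mono X′⊆X Y′⊆Y

  All-∙-finite : ∀ {Y Z δ} → All (Y ∙ Z) δ →
                 ∃₂ λ β γ → All Y β × All Z γ × All (⟨ β ⟩ ∙ ⟨ γ ⟩) δ
  All-∙-finite [] = [] , [] , [] , [] , []
  All-∙-finite {δ = d ∷ _} (app {η} Zη y ∷ rest) with All-∙-finite rest
  ... | β , γ , Yβ , Zγ , ds =
    (η ⇨ d) ∷ β , η ++ γ , y ∷ Yβ , ++⁺ Zη Zγ ,
    app (tabulate ∈-++⁺ˡ) (here refl) ∷ All.map (∙-mono there (∈-++⁺ʳ η)) ds

  Kᴹ Sᴹ Cᴹ : 𝒫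
  Kᴹ (α ⇨ β ⇨ a) = a ∈ α
  Kᴹ _ = ⊥
  Sᴹ (α ⇨ β ⇨ γ ⇨ b) = (⟨ α ⟩ ∙ ⟨ γ ⟩ ∙ (⟨ β ⟩ ∙ ⟨ γ ⟩)) b
  Sᴹ _ = ⊥
  Cᴹ (α ⇨ β ⇨ γ ⇨ b) = (atom true ∈ α × b ∈ β) ⊎ (atom false ∈ α × b ∈ γ) ⊎ (b ∈ β × b ∈ γ)
  Cᴹ _ = ⊥

  ⟦_⟧ : Term → 𝒫
  ⟦ var _ ⟧ = ∅
  ⟦ C ⟧ = Cᴹ
  ⟦ T ⟧ = ｛ atom true ｝
  ⟦ F ⟧ = ｛ atom false ｝
  ⟦ K ⟧ = Kᴹ
  ⟦ S ⟧ = Sᴹ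
  ⟦ s · t ⟧ = ⟦ s ⟧ ∙ ⟦ t ⟧

  K-law : ∀ X Y → Kᴹ ∙ X ∙ Y ≋ X
  K-law X Y = (λ { (app _ (app Xα a∈α)) → lookup Xα a∈α })
            , λ x → app [] (app (x ∷ []) (here refl))

  S-law : ∀ X Y Z → Sᴹ ∙ X ∙ Y ∙ Z ≋ X ∙ Z ∙ (Y ∙ Z)
  S-law X Y Z = to , from
    where
    to : Sᴹ ∙ X ∙ Y ∙ Z ⊆ X ∙ Z ∙ (Y ∙ Z)
    to (app Zγ (app Yβ (app Xα s))) =
      ∙-mono (∙-mono (lookup Xα) (lookup Zγ)) (∙-mono (lookup Yβ) (lookup Zγ)) s
    from : X ∙ Z ∙ (Y ∙ Z) ⊆ Sᴹ ∙ X ∙ Y ∙ Z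
    from (app YZδ (app {η} Zη x)) with All-∙-finite YZδ
    ... | _ , _ , Yβ , Zγ , ds =
      app (++⁺ Zη Zγ) (app Yβ (app (x ∷ [])
        (app (All.map (∙-mono id (∈-++⁺ʳ η)) ds) (app (tabulate ∈-++⁺ˡ) (here refl)))))

  CT-law : ∀ X Y → Cᴹ ∙ ⟦ T ⟧ ∙ X ∙ Y ≋ X
  CT-law X Y = to , λ x → app [] (app (x ∷ []) (app (refl ∷ []) (inj₁ (here refl , here refl))))
    where
    to : Cᴹ ∙ ⟦ T ⟧ ∙ X ∙ Y ⊆ X
    to (app _ (app Xβ (app _ (inj₁ (_ , b∈β))))) = lookup Xβ b∈β
    to (app _ (app _ (app Tα (inj₂ (inj₁ (f∈α , _)))))) with lookup Tα f∈α
    ... | ()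
    to (app _ (app Xβ (app _ (inj₂ (inj₂ (b∈β , _)))))) = lookup Xβ b∈β

  CF-law : ∀ X Y → Cᴹ ∙ ⟦ F ⟧ ∙ X ∙ Y ≋ Y
  CF-law X Y = to , λ y → app (y ∷ []) (app [] (app (refl ∷ []) (inj₂ (inj₁ (here refl , here refl)))))
    where
    to : Cᴹ ∙ ⟦ F ⟧ ∙ X ∙ Y ⊆ Y
    to (app _ (app _ (app Fα (inj₁ (t∈α , _))))) with lookup Fα t∈α
    ... | ()
    to (app Yγ (app _ (app _ (inj₂ (inj₁ (_ , b∈γ)))))) = lookup Yγ b∈γ
    to (app Yγ (app _ (app _ (inj₂ (inj₂ (_ , b∈γ)))))) = lookup Yγ b∈γ

  Cxx-law : ∀ Z X → Cᴹ ∙ Z ∙ X ∙ X ≋ X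
  Cxx-law Z X = to , λ x → app (x ∷ []) (app (x ∷ []) (app [] (inj₂ (inj₂ (here refl , here refl)))))
    where
    to : Cᴹ ∙ Z ∙ X ∙ X ⊆ X
    to (app _ (app Xβ (app _ (inj₁ (_ , b∈β))))) = lookup Xβ b∈β
    to (app Xγ (app _ (app _ (inj₂ (inj₁ (_ , b∈γ)))))) = lookup Xγ b∈γ
    to (app _ (app Xβ (app _ (inj₂ (inj₂ (b∈β , _)))))) = lookup Xβ b∈β

  ⟦⟧-⟶ʳ : ∀ {s t} → s ⟶ʳ t → ⟦ s ⟧ ≋ ⟦ t ⟧
  ⟦⟧-⟶ʳ (CT x y) = CT-law ⟦ x ⟧ ⟦ y ⟧
  ⟦⟧-⟶ʳ (CF x y) = CF-law ⟦ x ⟧ ⟦ y ⟧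
  ⟦⟧-⟶ʳ (Cxx z x) = Cxx-law ⟦ z ⟧ ⟦ x ⟧
  ⟦⟧-⟶ʳ (Kxy x y) = K-law ⟦ x ⟧ ⟦ y ⟧
  ⟦⟧-⟶ʳ (Sxyz x y z) = S-law ⟦ x ⟧ ⟦ y ⟧ ⟦ z ⟧

  ⟦⟧-⟶ : ∀ {s t} → s ⟶ t → ⟦ s ⟧ ≋ ⟦ t ⟧
  ⟦⟧-⟶ (root r) = ⟦⟧-⟶ʳ r
  ⟦⟧-⟶ (appˡ r) = ∙-cong (⟦⟧-⟶ r) ≋-refl
  ⟦⟧-⟶ (appʳ r) = ∙-cong ≋-refl (⟦⟧-⟶ r)

  ⟦⟧-≐ : ∀ {s t} → s ≐ t → ⟦ s ⟧ ≋ ⟦ t ⟧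
  ⟦⟧-≐ ε = ≋-refl
  ⟦⟧-≐ (fwd r ◅ c) = ≋-trans (⟦⟧-⟶ r) (⟦⟧-≐ c)
  ⟦⟧-≐ (bwd r ◅ c) = ≋-trans (≋-sym (⟦⟧-⟶ r)) (⟦⟧-≐ c)

T≉F : ¬ (T ≐ F)
T≉F T≐F with proj₁ (EngelerModel.⟦⟧-≐ T≐F) refl
... | ()

infix 4 _⇛_
infixl 9 _·_

data _⇛_ : Term → Term → Set where
  var : ∀ n → var n ⇛ var n
  C : C ⇛ C
  T : T ⇛ T
  F : F ⇛ F
  K : K ⇛ K
  S : S ⇛ S
  _·_ : ∀ {s s′ t t′} → s ⇛ s′ → t ⇛ t′ → s · t ⇛ s′ · t′
  CT : ∀ {x x′ y} → x ⇛ x′ → C · T · x · y ⇛ x′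
  CF : ∀ {x y y′} → y ⇛ y′ → C · F · x · y ⇛ y′
  Cxx-left : ∀ {z x x′ y} → x ⇛ x′ → x ≐ y → ¬ (z ≐ F) → C · z · x · y ⇛ x′
  Cxx-right : ∀ {z x y y′} → y ⇛ y′ → x ≐ y → z ≐ F → C · z · x · y ⇛ y′
  Kxy : ∀ {x x′ y} → x ⇛ x′ → K · x · y ⇛ x′
  Sxyz : ∀ {x x′ y y′ z z′} → x ⇛ x′ → y ⇛ y′ → z ⇛ z′ → S · x · y · z ⇛ x′ · z′ · (y′ · z′)

⇛-refl : ∀ t → t ⇛ t
⇛-refl (var n) = var n
⇛-refl C = C
⇛-refl T = T
⇛-refl F = F
⇛-refl K = K
⇛-refl S = S
⇛-refl (s · t) = ⇛-refl s · ⇛-refl t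

⇛⇒≐ : ∀ {s t} → s ⇛ t → s ≐ t
⇛⇒≐ (var n) = ε
⇛⇒≐ C = ε
⇛⇒≐ T = ε
⇛⇒≐ F = ε
⇛⇒≐ K = ε
⇛⇒≐ S = ε
⇛⇒≐ (ds · dt) = ≐-· (⇛⇒≐ ds) (⇛⇒≐ dt)
⇛⇒≐ (CT {x} {y = y} dx) = ⟶ʳ⇒≐ (CT x y) ◅◅ ⇛⇒≐ dx
⇛⇒≐ (CF {x} {y} dy) = ⟶ʳ⇒≐ (CF x y) ◅◅ ⇛⇒≐ dy
⇛⇒≐ (Cxx-left {z} {x} dx x≐y _) = ≐-·ʳ (C · z · x) (≐-sym x≐y) ◅◅ ⟶ʳ⇒≐ (Cxx z x) ◅◅ ⇛⇒≐ dx
⇛⇒≐ (Cxx-right {z} {y = y} dy x≐y _) = ≐-·ˡ y (≐-·ʳ (C · z) x≐y) ◅◅ ⟶ʳ⇒≐ (Cxx z y) ◅◅ ⇛⇒≐ dy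
⇛⇒≐ (Kxy {x} {y = y} dx) = ⟶ʳ⇒≐ (Kxy x y) ◅◅ ⇛⇒≐ dx
⇛⇒≐ (Sxyz {x} {y = y} {z = z} dx dy dz) =
  ⟶ʳ⇒≐ (Sxyz x y z) ◅◅ ≐-· (≐-· (⇛⇒≐ dx) (⇛⇒≐ dz)) (≐-· (⇛⇒≐ dy) (⇛⇒≐ dz))

⇛-resp-≐ : ∀ {x x′ y y′} → x ⇛ x′ → y ⇛ y′ → x ≐ y → x′ ≐ y′
⇛-resp-≐ dx dy x≐y = ≐-sym (⇛⇒≐ dx) ◅◅ x≐y ◅◅ ⇛⇒≐ dy

mutual
  ⇛-diamond : Diamond _⇛_
  ⇛-diamond (var n) (var n) = _ , var n , var n
  ⇛-diamond C C = _ , C , C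
  ⇛-diamond T T = _ , T , T
  ⇛-diamond F F = _ , F , F
  ⇛-diamond K K = _ , K , K
  ⇛-diamond S S = _ , S , S
  ⇛-diamond (ds · dt) q = ⇛-diamond-· ds dt q
  ⇛-diamond p (ds · dt) with ⇛-diamond-· ds dt p
  ... | _ , a , b = _ , b , a
  ⇛-diamond (CT dx) (CT dx′) = ⇛-diamond dx dx′
  ⇛-diamond (CT dx) (Cxx-left dx′ _ _) = ⇛-diamond dx dx′
  ⇛-diamond (CT _) (Cxx-right _ _ T≐F) = ⊥-elim (T≉F T≐F)
  ⇛-diamond (CF dy) (CF dy′) = ⇛-diamond dy dy′
  ⇛-diamond (CF _) (Cxx-left _ _ F≉F) = ⊥-elim (F≉F ε)
  ⇛-diamond (CF dy) (Cxx-right dy′ _ _) = ⇛-diamond dy dy′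
  ⇛-diamond (Cxx-left dx _ _) (CT dx′) = ⇛-diamond dx dx′
  ⇛-diamond (Cxx-left _ _ F≉F) (CF _) = ⊥-elim (F≉F ε)
  ⇛-diamond (Cxx-left dx _ _) (Cxx-left dx′ _ _) = ⇛-diamond dx dx′
  ⇛-diamond (Cxx-left _ _ z≉F) (Cxx-right _ _ z≐F) = ⊥-elim (z≉F z≐F)
  ⇛-diamond (Cxx-right _ _ T≐F) (CT _) = ⊥-elim (T≉F T≐F)
  ⇛-diamond (Cxx-right dy _ _) (CF dy′) = ⇛-diamond dy dy′
  ⇛-diamond (Cxx-right _ _ z≐F) (Cxx-left _ _ z≉F) = ⊥-elim (z≉F z≐F)
  ⇛-diamond (Cxx-right dy _ _) (Cxx-right dy′ _ _) = ⇛-diamond dy dy′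
  ⇛-diamond (Kxy dx) (Kxy dx′) = ⇛-diamond dx dx′
  ⇛-diamond (Sxyz dx dy dz) (Sxyz dx′ dy′ dz′)
    with ⇛-diamond dx dx′ | ⇛-diamond dy dy′ | ⇛-diamond dz dz′
  ... | _ , a , a′ | _ , b , b′ | _ , c , c′ = _ , a · c · (b · c) , a′ · c′ · (b′ · c′)

  ⇛-diamond-· : ∀ {s s′ t t′ u} → s ⇛ s′ → t ⇛ t′ → s · t ⇛ u → ∃[ v ] s′ · t′ ⇛ v × u ⇛ v
  ⇛-diamond-· ds dt (ds′ · dt′) with ⇛-diamond ds ds′ | ⇛-diamond dt dt′
  ... | _ , a , a′ | _ , b , b′ = _ , a · b , a′ · b′
  ⇛-diamond-· (C · T · dx) _ (CT dx′) with ⇛-diamond dx dx′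
  ... | _ , a , a′ = _ , CT a , a′
  ⇛-diamond-· (C · F · _) dy (CF dy′) with ⇛-diamond dy dy′
  ... | _ , a , a′ = _ , CF a , a′
  ⇛-diamond-· (C · dz · dx) dy (Cxx-left dx′ x≐y z≉F) with ⇛-diamond dx dx′
  ... | _ , a , a′ = _ , Cxx-left a (⇛-resp-≐ dx dy x≐y) (z≉F ∘ (⇛⇒≐ dz ◅◅_)) , a′
  ⇛-diamond-· (C · dz · dx) dy (Cxx-right dy′ x≐y z≐F) with ⇛-diamond dy dy′
  ... | _ , a , a′ = _ , Cxx-right a (⇛-resp-≐ dx dy x≐y) (≐-sym (⇛⇒≐ dz) ◅◅ z≐F) , a′
  ⇛-diamond-· (K · dx) _ (Kxy dx′) with ⇛-diamond dx dx′
  ... | _ , a , a′ = _ , Kxy a , a′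
  ⇛-diamond-· (S · dx · dy) dz (Sxyz dx′ dy′ dz′)
    with ⇛-diamond dx dx′ | ⇛-diamond dy dy′ | ⇛-diamond dz dz′
  ... | _ , a , a′ | _ , b , b′ | _ , c , c′ = _ , Sxyz a b c , a′ · c′ · (b′ · c′)

⇛-confluent : Confluent _⇛_
⇛-confluent = diamond⇒confluent ⇛-diamond

module _ where
  open RawMonad (¬¬-Monad {0ℓ})

  -- Excluded middle on z ≐ F is the only non-constructive step of the proof.
  ⟶ʳ⇒¬¬⇛ : ∀ {s t} → s ⟶ʳ t → ¬ ¬ (s ⇛ t)
  ⟶ʳ⇒¬¬⇛ (CT x y) = pure (CT (⇛-refl x))
  ⟶ʳ⇒¬¬⇛ (CF x y) = pure (CF (⇛-refl y))
  ⟶ʳ⇒¬¬⇛ (Cxx z x) = Cxx-⇛ <$> ¬¬-excluded-middle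
    where
    Cxx-⇛ : Dec (z ≐ F) → C · z · x · x ⇛ x
    Cxx-⇛ (yes z≐F) = Cxx-right (⇛-refl x) ε z≐F
    Cxx-⇛ (no z≉F) = Cxx-left (⇛-refl x) ε z≉F
  ⟶ʳ⇒¬¬⇛ (Kxy x y) = pure (Kxy (⇛-refl x))
  ⟶ʳ⇒¬¬⇛ (Sxyz x y z) = pure (Sxyz (⇛-refl x) (⇛-refl y) (⇛-refl z))

  ⟶⇒¬¬⇛ : ∀ {s t} → s ⟶ t → ¬ ¬ (s ⇛ t)
  ⟶⇒¬¬⇛ (root r) = ⟶ʳ⇒¬¬⇛ r
  ⟶⇒¬¬⇛ (appˡ {t = t} r) = (_· ⇛-refl t) <$> ⟶⇒¬¬⇛ r
  ⟶⇒¬¬⇛ (appʳ {s = s} r) = (⇛-refl s ·_) <$> ⟶⇒¬¬⇛ r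

  ≐⇒¬¬⇛-conv : ∀ {s t} → s ≐ t → ¬ ¬ EqClosure _⇛_ s t
  ≐⇒¬¬⇛-conv ε = pure ε
  ≐⇒¬¬⇛-conv (fwd r ◅ c) = _◅_ <$> (fwd <$> ⟶⇒¬¬⇛ r) ⊛ ≐⇒¬¬⇛-conv c
  ≐⇒¬¬⇛-conv (bwd r ◅ c) = _◅_ <$> (bwd <$> ⟶⇒¬¬⇛ r) ⊛ ≐⇒¬¬⇛-conv c

-- Comparing tags first lets the coverage checker dismiss all pairs of distinct constructors.
constructor-tag : Term → ℕ.ℕ
constructor-tag (var _) = 0
constructor-tag C = 1
constructor-tag T = 2
constructor-tag F = 3
constructor-tag K = 4
constructor-tag S = 5
constructor-tag (_ · _) = 6

_≟_ : DecidableEquality Term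
s ≟ t with constructor-tag s ℕ.≟ constructor-tag t
... | no tags≢ = no (tags≢ ∘ cong constructor-tag)
var m ≟ var n | yes _ = map′ (cong var) (λ { refl → refl }) (m ℕ.≟ n)
C ≟ C | yes _ = yes refl
T ≟ T | yes _ = yes refl
F ≟ F | yes _ = yes refl
K ≟ K | yes _ = yes refl
S ≟ S | yes _ = yes refl
(s · t) ≟ (s′ · t′) | yes _ = map′ (uncurry (cong₂ _·_)) (λ { refl → refl , refl }) (s ≟ s′ ×-dec t ≟ t′)

Rigid : Term → Set
Rigid t = ∀ {u} → t ⇛ u → u ≡ t

rigid-↠ : ∀ {t u} → Rigid t → Star _⇛_ t u → u ≡ t
rigid-↠ rigid ε = refl
rigid-↠ rigid (d ◅ ds) with rigid d
... | refl = rigid-↠ rigid ds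

rigid-unique : ∀ {s t} → Rigid s → Rigid t → s ≐ t → s ≡ t
rigid-unique {s} {t} rigid-s rigid-t s≐t =
  decidable-stable (s ≟ t) (¬¬-map joined (≐⇒¬¬⇛-conv s≐t))
  where
  joined : EqClosure _⇛_ s t → s ≡ t
  joined c with confluent⇒church-rosser ⇛-confluent c
  ... | _ , s↠u , t↠u = trans (sym (rigid-↠ rigid-s s↠u)) (rigid-↠ rigid-t t↠u)

NormalForm-·ˡ : ∀ {s t} → NormalForm (s · t) → NormalForm s
NormalForm-·ˡ nf s′⊑s = nf (inl s′⊑s)

NormalForm-·ʳ : ∀ {s t} → NormalForm (s · t) → NormalForm t
NormalForm-·ʳ nf t′⊑t = nf (inr t′⊑t)

mutual
  NormalForm⇒Rigid : ∀ t → NormalForm t → Rigid t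
  NormalForm⇒Rigid (var n) _ (var n) = refl
  NormalForm⇒Rigid C _ C = refl
  NormalForm⇒Rigid T _ T = refl
  NormalForm⇒Rigid F _ F = refl
  NormalForm⇒Rigid K _ K = refl
  NormalForm⇒Rigid S _ S = refl
  NormalForm⇒Rigid (s · t) nf (ds · dt) =
    cong₂ _·_ (NormalForm⇒Rigid s (NormalForm-·ˡ nf) ds) (NormalForm⇒Rigid t (NormalForm-·ʳ nf) dt)
  NormalForm⇒Rigid (C · T · x · y) nf (CT _) = ⊥-elim (nf here _ (CT x y))
  NormalForm⇒Rigid (C · F · x · y) nf (CF _) = ⊥-elim (nf here _ (CF x y))
  NormalForm⇒Rigid (C · z · x · y) nf (Cxx-left _ x≐y _) = ⊥-elim (NormalForm-C-branches-≉ z x y nf x≐y)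
  NormalForm⇒Rigid (C · z · x · y) nf (Cxx-right _ x≐y _) = ⊥-elim (NormalForm-C-branches-≉ z x y nf x≐y)
  NormalForm⇒Rigid (K · x · y) nf (Kxy _) = ⊥-elim (nf here _ (Kxy x y))
  NormalForm⇒Rigid (S · x · y · z) nf (Sxyz _ _ _) = ⊥-elim (nf here _ (Sxyz x y z))

  NormalForm-C-branches-≉ : ∀ z x y → NormalForm (C · z · x · y) → ¬ (x ≐ y)
  NormalForm-C-branches-≉ z x y nf x≐y
    with rigid-unique (NormalForm⇒Rigid x (NormalForm-·ʳ (NormalForm-·ˡ nf))) (NormalForm⇒Rigid y (NormalForm-·ʳ nf)) x≐y
  ... | refl = nf here _ (Cxx z x)

mainTheorem2 : ∀ (t₁ t₂ : Term) → NormalForm t₁ → NormalForm t₂ → t₁ ≐ t₂ → t₁ ≡ t₂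
mainTheorem2 t₁ t₂ nf₁ nf₂ = rigid-unique (NormalForm⇒Rigid t₁ nf₁) (NormalForm⇒Rigid t₂ nf₂)
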